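{- Let $G$ be a finite graph in which every maximal (by inclusion) independent set has size at least $\lambda$, and let $i_k$ denote the number of independent sets of size $k$ in $G$. Then $$i_0\le i_1\le \cdots\le i_{\lceil \lambda/2\rceil}.$$
   Context: An independent set in a graph is a set of mutually non-adjacent vertices; $i_0=1$ counts the empty set. -}

module Defs where

open import Data.Nat using (ℕ; zero; suc; _≤_; _<_; ⌈_/2⌉)
open import Data.Bool using (Bool; true; false; T)
open import Data.Fin using (Fin)
open import Data.Fin.Subset using (Subset; _∈_; _⊆_; ∣_∣)
open import Data.Fin.Subset.Properties using (_∈?_)
open import Data.Fin.Properties using (all?)
open import Data.List using (List; []; _∷_; map; _++_; length; filter)
open import Data.Vec using (_∷_; [])
open import Data.Bool.Properties using (T?)
open import Relation.Nullary using (¬_; Dec; yes; no)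
open import Relation.Nullary.Decidable using (_×-dec_; ¬?; _→-dec_)
open import Data.Product using (_×_)
open import Relation.Binary.PropositionalEquality using (_≡_)
open import Data.Nat using (_≟_)

record Graph (n : ℕ) : Set where
  field
    adj   : Fin n → Fin n → Bool
    sym   : ∀ x y → adj x y ≡ adj y x
    irrefl : ∀ x → adj x x ≡ false

open Graph public

Adj : ∀ {n} → Graph n → Fin n → Fin n → Set
Adj G x y = T (adj G x y)

Independent : ∀ {n} → Graph n → Subset n → Set
Independent G S = ∀ x y → x ∈ S → y ∈ S → ¬ Adj G x y

MaximalIndependent : ∀ {n} → Graph n → Subset n → Set
MaximalIndependent G S =
  Independent G S × (∀ T → Independent G T → S ⊆ T → T ⊆ S)

independent? : ∀ {n} (G : Graph n) (S : Subset n) → Dec (Independent G S)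
independent? G S =
  all? (λ x → all? (λ y → (x ∈? S) →-dec ((y ∈? S) →-dec ¬? (T? (adj G x y)))))

allSubsets : (n : ℕ) → List (Subset n)
allSubsets zero = [] ∷ []
allSubsets (suc n) = map (false ∷_) (allSubsets n) ++ map (true ∷_) (allSubsets n)

indepCount : ∀ {n} → Graph n → ℕ → ℕ
indepCount {n} G k =
  length (filter (λ S → independent? G S ×-dec (∣ S ∣ ≟ k)) (allSubsets n))

-- Double counting of the pairs (A, v) with A an independent k-set and A ∪ {v}
-- an independent (k+1)-set.  Each independent (k+1)-set B arises from exactly
-- k+1 such pairs, one for each v ∈ B.  Each independent k-set A extends to a
-- maximal independent set M, which has at least λ elements, and every vertex
-- of M outside A can be added to A; so A lies in at least λ − k pairs.  Hence
-- (λ − k) i_k ≤ (k + 1) i_{k+1}, and λ − k ≥ k + 1 as long as k < ⌈λ/2⌉.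
module Submission where

open import Defs hiding (sym)
open import Data.Nat using (ℕ; zero; suc; _+_; _*_; _∸_; _≤_; _<_; _≟_; ⌈_/2⌉; z≤n; s≤s)
open import Data.Nat.Properties
open import Data.Nat.ListAction using (sum)
open import Data.Nat.ListAction.Properties using (sum-++)
open import Algebra.Properties.Semiring.Sum +-*-semiring
  using (sum-syntax; ∑-distrib-+; *-distribˡ-sum; *-distribʳ-sum; sum-replicate-zero; sum-cong-≗)
open import Data.Bool using (Bool; true; false; not; _∧_)
open import Data.Fin using (Fin; zero; suc)
open import Data.Fin.Properties using (any?)
open import Data.Fin.Subset using (Subset; inside; outside; _∈_; _∉_; _⊆_; ∣_∣)
open import Data.Fin.Subset.Properties using (_∈?_; ∣p∣≤n)
open import Data.Vec using ([]; _∷_; here; there; _[_]≔_)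
open import Data.List using (List; []; _∷_; _++_; map; filter; length)
open import Data.List.Properties using (map-++; map-cong; map-∘)
open import Data.Product using (_×_; _,_; ∃)
open import Data.Sum using (_⊎_; inj₁; inj₂; [_,_]′)
open import Data.Empty using (⊥-elim)
open import Function using (_∘_; id; _⇔_; mk⇔)
open import Relation.Nullary using (Dec; yes; no; does; ¬?; _×-dec_)
open import Relation.Nullary.Decidable using (does-⇔; dec-true)
open import Relation.Unary using (Pred; Decidable)
open import Relation.Binary.PropositionalEquality
  using (_≡_; refl; sym; trans; cong; cong₂; subst; module ≡-Reasoning)

𝟙 : Bool → ℕ
𝟙 true  = 1
𝟙 false = 0

𝟙-∧ : ∀ a b → 𝟙 (a ∧ b) ≡ 𝟙 a * 𝟙 b
𝟙-∧ true  b = sym (*-identityˡ (𝟙 b))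
𝟙-∧ false b = refl

module _ {a b c} {A : Set a} {B : Set b} {C : Set c} where

  𝟙-≤-⊎ : (A → B ⊎ C) → (a? : Dec A) (b? : Dec B) (c? : Dec C) →
          𝟙 (does a?) ≤ 𝟙 (does b?) + 𝟙 (does c?)
  𝟙-≤-⊎ split (no _)  b? c? = z≤n
  𝟙-≤-⊎ split (yes x) b? c? with split x
  ... | inj₁ y rewrite dec-true b? y = s≤s z≤n
  ... | inj₂ z rewrite dec-true c? z = m≤n+m 1 _

module _ {a} {A : Set a} where

  𝟙-*-monoʳ-≤ : ∀ {m n} → (A → m ≤ n) → (a? : Dec A) → 𝟙 (does a?) * m ≤ 𝟙 (does a?) * n
  𝟙-*-monoʳ-≤ m≤n (yes x) = *-monoʳ-≤ 1 (m≤n x)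
  𝟙-*-monoʳ-≤ m≤n (no _)  = z≤n

  𝟙-*-congˡ : ∀ {m n} → (A → m ≡ n) → (a? : Dec A) → m * 𝟙 (does a?) ≡ n * 𝟙 (does a?)
  𝟙-*-congˡ         m≡n (yes x) = cong (_* 1) (m≡n x)
  𝟙-*-congˡ {m} {n} m≡n (no _)  = trans (*-zeroʳ m) (sym (*-zeroʳ n))

∑-mono-≤ : ∀ {n} {f g : Fin n → ℕ} → (∀ i → f i ≤ g i) → ∑[ i < n ] f i ≤ ∑[ i < n ] g i
∑-mono-≤ {zero}  f≤g = z≤n
∑-mono-≤ {suc n} f≤g = +-mono-≤ (f≤g zero) (∑-mono-≤ (f≤g ∘ suc))

module _ {a} {A : Set a} where

  length-filter≡sum-𝟙 : ∀ {p} {P : Pred A p} (P? : Decidable P) xs →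
                        length (filter P? xs) ≡ sum (map (λ x → 𝟙 (does (P? x))) xs)
  length-filter≡sum-𝟙 P? []       = refl
  length-filter≡sum-𝟙 P? (x ∷ xs) with does (P? x)
  ... | true  = cong suc (length-filter≡sum-𝟙 P? xs)
  ... | false = length-filter≡sum-𝟙 P? xs

  sum-map-mono-≤ : ∀ {f g : A → ℕ} xs → (∀ x → f x ≤ g x) → sum (map f xs) ≤ sum (map g xs)
  sum-map-mono-≤ []       f≤g = z≤n
  sum-map-mono-≤ (x ∷ xs) f≤g = +-mono-≤ (f≤g x) (sum-map-mono-≤ xs f≤g)

  *-distribˡ-sum-map : ∀ c (f : A → ℕ) xs → c * sum (map f xs) ≡ sum (map (λ x → c * f x) xs)
  *-distribˡ-sum-map c f []       = *-zeroʳ c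
  *-distribˡ-sum-map c f (x ∷ xs) =
    trans (*-distribˡ-+ c (f x) _) (cong (c * f x +_) (*-distribˡ-sum-map c f xs))

  sum-map-∑-comm : ∀ {n} (f : A → Fin n → ℕ) xs →
                   sum (map (λ x → ∑[ i < n ] f x i) xs) ≡ ∑[ i < n ] sum (map (λ x → f x i) xs)
  sum-map-∑-comm {n} f []       = sym (sum-replicate-zero n)
  sum-map-∑-comm     f (x ∷ xs) =
    trans (cong ((∑[ i < _ ] f x i) +_) (sum-map-∑-comm f xs)) (sym (∑-distrib-+ (f x) _))

p⊆p[x]≔inside : ∀ {n} (p : Subset n) x → p ⊆ p [ x ]≔ inside
p⊆p[x]≔inside (_ ∷ p) zero    here         = here
p⊆p[x]≔inside (_ ∷ p) zero    (there y∈p)  = there y∈p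
p⊆p[x]≔inside (_ ∷ p) (suc x) here         = here
p⊆p[x]≔inside (_ ∷ p) (suc x) (there y∈p)  = there (p⊆p[x]≔inside p x y∈p)

x∈p[y]≔inside⁻ : ∀ {n} (p : Subset n) {x} y → x ∈ p [ y ]≔ inside → x ∈ p ⊎ x ≡ y
x∈p[y]≔inside⁻ (_ ∷ p) zero    here        = inj₂ refl
x∈p[y]≔inside⁻ (_ ∷ p) zero    (there x∈p) = inj₁ (there x∈p)
x∈p[y]≔inside⁻ (_ ∷ p) (suc y) here        = inj₁ here
x∈p[y]≔inside⁻ (_ ∷ p) (suc y) (there x∈) with x∈p[y]≔inside⁻ p y x∈
... | inj₁ x∈p = inj₁ (there x∈p)
... | inj₂ refl = inj₂ refl

p[x]≔inside⊆q : ∀ {n} {p q : Subset n} {x} → x ∈ q → p ⊆ q → p [ x ]≔ inside ⊆ q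
p[x]≔inside⊆q {p = p} {x = x} x∈q p⊆q y∈ with x∈p[y]≔inside⁻ p x y∈
... | inj₁ y∈p = p⊆q y∈p
... | inj₂ refl = x∈q

∣p[x]≔inside∣≡1+∣p∣ : ∀ {n} (p : Subset n) x → x ∉ p → ∣ p [ x ]≔ inside ∣ ≡ suc ∣ p ∣
∣p[x]≔inside∣≡1+∣p∣ (outside ∷ p) zero    x∉p = refl
∣p[x]≔inside∣≡1+∣p∣ (inside  ∷ p) zero    x∉p = ⊥-elim (x∉p here)
∣p[x]≔inside∣≡1+∣p∣ (outside ∷ p) (suc x) x∉p = ∣p[x]≔inside∣≡1+∣p∣ p x (x∉p ∘ there)
∣p[x]≔inside∣≡1+∣p∣ (inside  ∷ p) (suc x) x∉p = cong suc (∣p[x]≔inside∣≡1+∣p∣ p x (x∉p ∘ there))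

∣p∣≡∑𝟙∈ : ∀ {n} (p : Subset n) → ∣ p ∣ ≡ ∑[ x < n ] 𝟙 (does (x ∈? p))
∣p∣≡∑𝟙∈ []            = refl
∣p∣≡∑𝟙∈ (inside  ∷ p) = cong suc (∣p∣≡∑𝟙∈ p)
∣p∣≡∑𝟙∈ (outside ∷ p) = ∣p∣≡∑𝟙∈ p

sum-allSubsets-suc : ∀ {n} (f : Subset (suc n) → ℕ) →
  sum (map f (allSubsets (suc n)))
    ≡ sum (map (f ∘ (outside ∷_)) (allSubsets n)) + sum (map (f ∘ (inside ∷_)) (allSubsets n))
sum-allSubsets-suc {n} f = begin
  sum (map f (map (outside ∷_) L ++ map (inside ∷_) L))
    ≡⟨ cong sum (map-++ f (map (outside ∷_) L) (map (inside ∷_) L)) ⟩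
  sum (map f (map (outside ∷_) L) ++ map f (map (inside ∷_) L))
    ≡⟨ sum-++ (map f (map (outside ∷_) L)) (map f (map (inside ∷_) L)) ⟩
  sum (map f (map (outside ∷_) L)) + sum (map f (map (inside ∷_) L))
    ≡⟨ cong₂ _+_ (cong sum (map-∘ {g = f} L)) (cong sum (map-∘ {g = f} L)) ⟨
  sum (map (f ∘ (outside ∷_)) L) + sum (map (f ∘ (inside ∷_)) L)
    ∎
  where
  open ≡-Reasoning
  L : List (Subset n)
  L = allSubsets n

-- Inserting v is a bijection from the subsets avoiding v onto those containing v.
sum-insertions : ∀ {n} (v : Fin n) (f : Subset n → ℕ) →
  sum (map (λ A → 𝟙 (not (does (v ∈? A))) * f (A [ v ]≔ inside)) (allSubsets n))
    ≡ sum (map (λ B → 𝟙 (does (v ∈? B)) * f B) (allSubsets n))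
sum-insertions {suc n} zero f =
  trans (sum-allSubsets-suc {n} (λ A → 𝟙 (not (does (zero ∈? A))) * f (A [ zero ]≔ inside)))
    (trans (+-comm (sum (map (λ S → 1 * f (inside ∷ S)) (allSubsets n))) (sum (map (λ _ → 0) (allSubsets n))))
      (sym (sum-allSubsets-suc {n} (λ B → 𝟙 (does (zero ∈? B)) * f B))))
sum-insertions {suc n} (suc v) f =
  trans (sum-allSubsets-suc {n} (λ A → 𝟙 (not (does (suc v ∈? A))) * f (A [ suc v ]≔ inside)))
    (trans (cong₂ _+_ (sum-insertions v (f ∘ (outside ∷_))) (sum-insertions v (f ∘ (inside ∷_))))
      (sym (sum-allSubsets-suc {n} (λ B → 𝟙 (does (suc v ∈? B)) * f B))))

k<⌈n/2⌉⇒k+k<n : ∀ k n → k < ⌈ n /2⌉ → k + k < n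
k<⌈n/2⌉⇒k+k<n zero    (suc n)       _         = s≤s z≤n
k<⌈n/2⌉⇒k+k<n (suc k) (suc zero)    (s≤s ())
k<⌈n/2⌉⇒k+k<n (suc k) (suc (suc n)) (s≤s k<) =
  s≤s (s≤s (≤-trans (≤-reflexive (+-suc k k)) (k<⌈n/2⌉⇒k+k<n k n k<)))

module _ {n} (G : Graph n) where

  independent-⊆ : ∀ {p q} → Independent G q → p ⊆ q → Independent G p
  independent-⊆ indq p⊆q x y x∈p y∈p = indq x y (p⊆q x∈p) (p⊆q y∈p)

  Extends : Subset n → Fin n → Set
  Extends A v = v ∉ A × Independent G (A [ v ]≔ inside)

  extends? : ∀ A v → Dec (Extends A v)
  extends? A v = ¬? (v ∈? A) ×-dec independent? G (A [ v ]≔ inside)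

  extensionCount : Subset n → ℕ
  extensionCount A = ∑[ v < n ] 𝟙 (does (extends? A v))

  ∈-or-extends : ∀ {A M v} → Independent G M → A ⊆ M → v ∈ M → v ∈ A ⊎ Extends A v
  ∈-or-extends {A} {v = v} indM A⊆M v∈M with v ∈? A
  ... | yes v∈A = inj₁ v∈A
  ... | no  v∉A = inj₂ (v∉A , independent-⊆ indM (p[x]≔inside⊆q v∈M A⊆M))

  maximal-or-extends : ∀ {A} → Independent G A → MaximalIndependent G A ⊎ ∃ (Extends A)
  maximal-or-extends {A} indA with any? (extends? A)
  ... | yes ext = inj₂ ext
  ... | no ¬ext = inj₁ (indA , λ T indT A⊆T {x} x∈T →
                   [ id , (λ ext → ⊥-elim (¬ext (x , ext))) ]′ (∈-or-extends indT A⊆T x∈T))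

  maximal-extension : ∀ {A} → Independent G A → ∃ λ M → MaximalIndependent G M × A ⊆ M
  maximal-extension {A} = grow n (m≤m+n n ∣ A ∣)
    where
    grow : ∀ fuel {A} → n ≤ fuel + ∣ A ∣ → Independent G A → ∃ λ M → MaximalIndependent G M × A ⊆ M
    grow fuel {A} n≤ indA with maximal-or-extends indA
    ... | inj₁ maxA = A , maxA , id
    ... | inj₂ (v , v∉A , indA+v) with fuel
    ...   | zero = ⊥-elim (<⇒≱ (subst (_≤ n) (∣p[x]≔inside∣≡1+∣p∣ A v v∉A) (∣p∣≤n (A [ v ]≔ inside))) n≤)
    ...   | suc fuel′
            with grow fuel′ (subst (λ m → n ≤ fuel′ + m) (sym (∣p[x]≔inside∣≡1+∣p∣ A v v∉A))
                              (subst (n ≤_) (sym (+-suc fuel′ ∣ A ∣)) n≤)) indA+v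
    ...     | M , maxM , A+v⊆M = M , maxM , λ x∈A → A+v⊆M (p⊆p[x]≔inside A v x∈A)

  ∣M∣≤∣A∣+extensionCount : ∀ {A M} → Independent G M → A ⊆ M → ∣ M ∣ ≤ ∣ A ∣ + extensionCount A
  ∣M∣≤∣A∣+extensionCount {A} {M} indM A⊆M = begin
    ∣ M ∣                                                        ≡⟨ ∣p∣≡∑𝟙∈ M ⟩
    ∑[ v < n ] 𝟙 (does (v ∈? M))                                 ≤⟨ ∑-mono-≤ 𝟙∈M≤𝟙∈A+𝟙ext ⟩
    ∑[ v < n ] (𝟙 (does (v ∈? A)) + 𝟙 (does (extends? A v)))    ≡⟨ ∑-distrib-+ {n} (λ v → 𝟙 (does (v ∈? A))) (λ v → 𝟙 (does (extends? A v))) ⟩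
    ∑[ v < n ] 𝟙 (does (v ∈? A)) + extensionCount A             ≡⟨ cong (_+ extensionCount A) (∣p∣≡∑𝟙∈ A) ⟨
    ∣ A ∣ + extensionCount A                                     ∎
    where
    open ≤-Reasoning
    𝟙∈M≤𝟙∈A+𝟙ext : ∀ v → 𝟙 (does (v ∈? M)) ≤ 𝟙 (does (v ∈? A)) + 𝟙 (does (extends? A v))
    𝟙∈M≤𝟙∈A+𝟙ext v = 𝟙-≤-⊎ (∈-or-extends indM A⊆M) (v ∈? M) (v ∈? A) (extends? A v)

  extensionCount-lower-bound : ∀ λ′ → (∀ S → MaximalIndependent G S → λ′ ≤ ∣ S ∣) →
                               ∀ {A} → Independent G A → λ′ ≤ ∣ A ∣ + extensionCount A
  extensionCount-lower-bound λ′ maximal-large indA with maximal-extension indA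
  ... | M , maxM@(indM , _) , A⊆M = ≤-trans (maximal-large M maxM) (∣M∣≤∣A∣+extensionCount indM A⊆M)

  IndependentOfSize : ℕ → Subset n → Set
  IndependentOfSize k A = Independent G A × ∣ A ∣ ≡ k

  independentOfSize? : ∀ k A → Dec (IndependentOfSize k A)
  independentOfSize? k A = independent? G A ×-dec (∣ A ∣ ≟ k)

  independentOfSizeᵇ : ℕ → Subset n → Bool
  independentOfSizeᵇ k A = does (independentOfSize? k A)

  indepCount≡sum-𝟙 : ∀ k → indepCount G k ≡ sum (map (𝟙 ∘ independentOfSizeᵇ k) (allSubsets n))
  indepCount≡sum-𝟙 k = length-filter≡sum-𝟙 (independentOfSize? k) (allSubsets n)

  ofSize×Extends⇔∉×insert-ofSize : ∀ k A v →
    (IndependentOfSize k A × Extends A v) ⇔ (v ∉ A × IndependentOfSize (suc k) (A [ v ]≔ inside))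
  ofSize×Extends⇔∉×insert-ofSize k A v = mk⇔
    (λ { ((_ , ∣A∣≡k) , v∉A , indA+v) → v∉A , indA+v , trans (∣p[x]≔inside∣≡1+∣p∣ A v v∉A) (cong suc ∣A∣≡k) })
    (λ { (v∉A , indA+v , ∣A+v∣≡1+k) →
           (independent-⊆ indA+v (p⊆p[x]≔inside A v) ,
            suc-injective (trans (sym (∣p[x]≔inside∣≡1+∣p∣ A v v∉A)) ∣A+v∣≡1+k)) ,
           v∉A , indA+v })

  pair-indicator : ∀ k A v →
    𝟙 (independentOfSizeᵇ k A) * 𝟙 (does (extends? A v))
      ≡ 𝟙 (not (does (v ∈? A))) * 𝟙 (independentOfSizeᵇ (suc k) (A [ v ]≔ inside))
  pair-indicator k A v = begin
    𝟙 (independentOfSizeᵇ k A) * 𝟙 (does (extends? A v))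
      ≡⟨ 𝟙-∧ (independentOfSizeᵇ k A) (does (extends? A v)) ⟨
    𝟙 (does (independentOfSize? k A ×-dec extends? A v))
      ≡⟨ cong 𝟙 (does-⇔ (ofSize×Extends⇔∉×insert-ofSize k A v) (independentOfSize? k A ×-dec extends? A v)
                   (¬? (v ∈? A) ×-dec independentOfSize? (suc k) A+v)) ⟩
    𝟙 (does (¬? (v ∈? A) ×-dec independentOfSize? (suc k) A+v))
      ≡⟨ 𝟙-∧ (not (does (v ∈? A))) (independentOfSizeᵇ (suc k) A+v) ⟩
    𝟙 (not (does (v ∈? A))) * 𝟙 (independentOfSizeᵇ (suc k) A+v)
      ∎
    where
    open ≡-Reasoning
    A+v : Subset n
    A+v = A [ v ]≔ inside

  pairCount : ℕ → ℕ
  pairCount k = sum (map (λ A → 𝟙 (independentOfSizeᵇ k A) * extensionCount A) (allSubsets n))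

  pairCount≡1+k*indepCount : ∀ k → pairCount k ≡ suc k * indepCount G (suc k)
  pairCount≡1+k*indepCount k = begin
    sum (map (λ A → 𝟙 (I k A) * extensionCount A) L)
      ≡⟨ cong sum (map-cong pairs-at-A L) ⟩
    sum (map (λ A → ∑[ v < n ] insertionWeight v A) L)
      ≡⟨ sum-map-∑-comm (λ A v → insertionWeight v A) L ⟩
    ∑[ v < n ] sum (map (insertionWeight v) L)
      ≡⟨ sum-cong-≗ (λ v → sum-insertions v (𝟙 ∘ I (suc k))) ⟩
    ∑[ v < n ] sum (map (membershipWeight v) L)
      ≡⟨ sum-map-∑-comm (λ B v → membershipWeight v B) L ⟨
    sum (map (λ B → ∑[ v < n ] membershipWeight v B) L)
      ≡⟨ cong sum (map-cong pairs-at-B L) ⟩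
    sum (map (λ B → suc k * 𝟙 (I (suc k) B)) L)
      ≡⟨ *-distribˡ-sum-map (suc k) (𝟙 ∘ I (suc k)) L ⟨
    suc k * sum (map (𝟙 ∘ I (suc k)) L)
      ≡⟨ cong (suc k *_) (indepCount≡sum-𝟙 (suc k)) ⟨
    suc k * indepCount G (suc k)
      ∎
    where
    open ≡-Reasoning
    L : List (Subset n)
    L = allSubsets n
    I : ℕ → Subset n → Bool
    I = independentOfSizeᵇ

    insertionWeight membershipWeight : Fin n → Subset n → ℕ
    insertionWeight  v A = 𝟙 (not (does (v ∈? A))) * 𝟙 (I (suc k) (A [ v ]≔ inside))
    membershipWeight v B = 𝟙 (does (v ∈? B)) * 𝟙 (I (suc k) B)

    pairs-at-A : ∀ A → 𝟙 (I k A) * extensionCount A ≡ ∑[ v < n ] insertionWeight v A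
    pairs-at-A A = trans (*-distribˡ-sum {n} (𝟙 (I k A)) (𝟙 ∘ does ∘ extends? A)) (sum-cong-≗ {n} (pair-indicator k A))

    pairs-at-B : ∀ B → ∑[ v < n ] membershipWeight v B ≡ suc k * 𝟙 (I (suc k) B)
    pairs-at-B B = begin
      ∑[ v < n ] membershipWeight v B          ≡⟨ *-distribʳ-sum {n} (𝟙 (I (suc k) B)) (λ v → 𝟙 (does (v ∈? B))) ⟨
      (∑[ v < n ] 𝟙 (does (v ∈? B))) * 𝟙 (I (suc k) B) ≡⟨ cong (_* 𝟙 (I (suc k) B)) (∣p∣≡∑𝟙∈ B) ⟨
      ∣ B ∣ * 𝟙 (I (suc k) B)                  ≡⟨ 𝟙-*-congˡ (λ (_ , ∣B∣≡1+k) → ∣B∣≡1+k) (independentOfSize? (suc k) B) ⟩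
      suc k * 𝟙 (I (suc k) B)                  ∎

  pairCount-lower-bound : ∀ λ′ → (∀ S → MaximalIndependent G S → λ′ ≤ ∣ S ∣) → ∀ k →
    (λ′ ∸ k) * indepCount G k ≤ pairCount k
  pairCount-lower-bound λ′ maximal-large k = begin
    (λ′ ∸ k) * indepCount G k                          ≡⟨ cong ((λ′ ∸ k) *_) (indepCount≡sum-𝟙 k) ⟩
    (λ′ ∸ k) * sum (map (𝟙 ∘ I) L)                     ≡⟨ *-distribˡ-sum-map (λ′ ∸ k) (𝟙 ∘ I) L ⟩
    sum (map (λ A → (λ′ ∸ k) * 𝟙 (I A)) L)             ≡⟨ cong sum (map-cong (λ A → *-comm (λ′ ∸ k) (𝟙 (I A))) L) ⟩
    sum (map (λ A → 𝟙 (I A) * (λ′ ∸ k)) L)             ≤⟨ sum-map-mono-≤ L (λ A → 𝟙-*-monoʳ-≤ λ′∸k≤extensionCount (independentOfSize? k A)) ⟩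
    sum (map (λ A → 𝟙 (I A) * extensionCount A) L)     ∎
    where
    open ≤-Reasoning
    L : List (Subset n)
    L = allSubsets n
    I : Subset n → Bool
    I = independentOfSizeᵇ k

    λ′∸k≤extensionCount : ∀ {A} → IndependentOfSize k A → λ′ ∸ k ≤ extensionCount A
    λ′∸k≤extensionCount {A} (indA , refl) =
      m≤n+o⇒m∸n≤o λ′ ∣ A ∣ (extensionCount-lower-bound λ′ maximal-large indA)

theorem1p5 : ∀ {n} (G : Graph n) (λ′ : ℕ) →
    (∀ (S : Subset n) → MaximalIndependent G S → λ′ ≤ ∣ S ∣) →
    ∀ k → k < ⌈ λ′ /2⌉ → indepCount G k ≤ indepCount G (suc k)
theorem1p5 G λ′ maximal-large k k<⌈λ′/2⌉ = *-cancelˡ-≤ (suc k) (begin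
  suc k * indepCount G k                                ≤⟨ *-monoˡ-≤ (indepCount G k) 1+k≤λ′∸k ⟩
  (λ′ ∸ k) * indepCount G k                             ≤⟨ pairCount-lower-bound G λ′ maximal-large k ⟩
  pairCount G k                                         ≡⟨ pairCount≡1+k*indepCount G k ⟩
  suc k * indepCount G (suc k)                          ∎)
  where
  open ≤-Reasoning
  1+k≤λ′∸k : suc k ≤ λ′ ∸ k
  1+k≤λ′∸k = m+n≤o⇒m≤o∸n (suc k) (k<⌈n/2⌉⇒k+k<n k λ′ k<⌈λ′/2⌉)
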